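{- For integers $n>m\ge0$, $$ n\,p(n,m)=1+\sum_{m<k<n-m}p(k,m).$$
   Context: For $n\ge1$, $p(n,m)$ denotes the proportion of permutations in the symmetric group $S_n$ which have no cycles of length $\le m$ (fixed points count as cycles of length 1); by convention $p(0,m)=1$. -}

module Defs where

open import Data.Nat using (ℕ; zero; suc; _<_; _∸_; _!)
open import Data.Nat.Properties using (_!≢0; _<?_)
open import Data.Fin using (Fin; toℕ)
open import Data.Fin.Properties using (all?) renaming (_≟_ to _≟ᶠ_)
open import Data.Vec using (Vec; []; _∷_; lookup)
open import Data.List using (List; []; _∷_; concatMap; map; filter; length; upTo; foldr)
open import Data.Integer using (+_)
open import Data.Rational using (ℚ; _/_; _+_; 0ℚ)
open import Data.Product using (_×_)
open import Relation.Binary.PropositionalEquality using (_≡_; _≢_)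
open import Relation.Nullary using (Dec; ¬?; _×-dec_; _→-dec_)

allVecs : (n k : ℕ) → List (Vec (Fin n) k)
allVecs n zero    = [] ∷ []
allVecs n (suc k) = concatMap (λ x → map (x ∷_) (allVecs n k)) (Data.List.allFin n)
  where import Data.List

-- A map σ : Fin n → Fin n (given by its table) is a permutation iff it is injective.
IsPerm : {n : ℕ} → Vec (Fin n) n → Set
IsPerm σ = ∀ i j → lookup σ i ≡ lookup σ j → i ≡ j

isPerm? : {n : ℕ} → (σ : Vec (Fin n) n) → Dec (IsPerm σ)
isPerm? σ = all? λ i → all? λ j → (lookup σ i ≟ᶠ lookup σ j) →-dec (i ≟ᶠ j)

iter : {n : ℕ} → Vec (Fin n) n → ℕ → Fin n → Fin n
iter σ zero    i = i
iter σ (suc k) i = lookup σ (iter σ k i)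

-- σ has no cycle of length ≤ m: no point i lies on a cycle of length ≤ m,
-- i.e. σ^k(i) ≠ i for all i and all 1 ≤ k ≤ m (k = suc (toℕ j), j : Fin m).
NoShortCycle : {n : ℕ} → ℕ → Vec (Fin n) n → Set
NoShortCycle m σ = ∀ i (j : Fin m) → iter σ (suc (toℕ j)) i ≢ i

noShortCycle? : {n : ℕ} → (m : ℕ) → (σ : Vec (Fin n) n) → Dec (NoShortCycle m σ)
noShortCycle? m σ = all? λ i → all? λ j → ¬? (iter σ (suc (toℕ j)) i ≟ᶠ i)

count : ℕ → ℕ → ℕ
count n m = length (filter (λ σ → isPerm? σ ×-dec noShortCycle? m σ) (allVecs n n))

-- p(n,m) = count / n!   (for n = 0 this gives 1/1 = 1, matching the convention)
p : ℕ → ℕ → ℚ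
p n m = (+ count n m) / (n !)
  where instance _ = n !≢0

sumP : ℕ → ℕ → ℚ
sumP n m = foldr (λ k acc → p k m + acc) 0ℚ (filter (m <?_) (upTo (n ∸ m)))

{-# OPTIONS --safe #-}
module Submission where

-- Sort the permutations of {0, …, n} by the cycle of 0. Let r(n, L) count those whose
-- cycles of length ≤ m all pass through 0 and have length ≥ L. Deleting 0 from its cycle
-- is a bijection S(n+1) ≅ {0, …, n} × S(n) (record the predecessor of 0, or that 0 was
-- fixed) which shortens the cycle of 0 by one and leaves the other cycles alone. Hence
-- r(n+1, L+2) = (n+1) r(n, L+1) for L < m, r(n+1, 1) = c(n+1) + (n+1) r(n, 1) and
-- r(0, 1) = 1, where c counts permutations without short cycles and c(n+1) = r(n, m+1).
-- The first recurrence gives c(m+k+1) k! = (m+k)! r(k, 1), the second r(k, 1)/k! =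
-- Σ_{i ≤ k} p(i, m); so n p(n, m) = Σ_{i < n-m} p(i, m), where p(0, m) = 1 and
-- p(i, m) = 0 for 1 ≤ i ≤ m.

module ListCounting where

  open import Data.Nat using (ℕ; zero; suc; _+_; _*_; _≤_; z≤n; s≤s)
  open import Data.Nat.Properties using (≤-antisym; +-suc)
  open import Data.Nat.ListAction using (sum)
  open import Data.Fin using (Fin; zero; suc)
  open import Data.List using (List; []; _∷_; _++_; map; filter; length; cartesianProduct; tabulate; allFin)
  open import Data.List.Properties using (length-map; length-++; filter-++; map-tabulate; length-tabulate)
  open import Function using (_∘_; id)
  open import Data.List.Membership.Propositional using (_∈_)
  open import Data.List.Membership.Propositional.Properties using (∈-filter⁺; ∈-filter⁻; ∈-map⁺; ∈-∃++; ∈-++⁻; ∈-++⁺ˡ; ∈-++⁺ʳ; ∈-cartesianProduct⁺; ∈-allFin)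
  open import Data.List.Relation.Binary.Subset.Propositional using (_⊆_)
  open import Data.List.Relation.Unary.All using (lookup)
  open import Data.List.Relation.Unary.Any using (here; there)
  open import Data.List.Relation.Unary.Unique.Propositional using (Unique; []; _∷_)
  open import Data.List.Relation.Unary.Unique.Propositional.Properties using (filter⁺; cartesianProduct⁺; allFin⁺)
  open import Data.Product using (_×_; _,_)
  open import Data.Sum using (inj₁; inj₂)
  open import Data.Empty using (⊥-elim)
  open import Relation.Nullary using (yes; no)
  open import Relation.Unary using (Pred; Decidable)
  open import Relation.Binary.PropositionalEquality

  Enumeration : ∀ {a} (A : Set a) → List A → Set a
  Enumeration A xs = Unique xs × (∀ x → x ∈ xs)

  allFin-enumeration : ∀ n → Enumeration (Fin n) (allFin n)
  allFin-enumeration n = allFin⁺ n , ∈-allFin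

  cartesianProduct-enumeration : ∀ {a b} {A : Set a} {B : Set b} {xs ys} →
    Enumeration A xs → Enumeration B ys → Enumeration (A × B) (cartesianProduct xs ys)
  cartesianProduct-enumeration (xs! , xs-complete) (ys! , ys-complete) =
    cartesianProduct⁺ xs! ys! , λ (x , y) → ∈-cartesianProduct⁺ (xs-complete x) (ys-complete y)

  module _ {a} {A : Set a} where

    length-≤-if-unique-⊆ : ∀ {xs ys : List A} → Unique xs → xs ⊆ ys → length xs ≤ length ys
    length-≤-if-unique-⊆ {[]} _ _ = z≤n
    length-≤-if-unique-⊆ {x ∷ xs} (x∉xs ∷ xs!) xs⊆ys with ∈-∃++ (xs⊆ys (here refl))
    ... | us , vs , refl = subst (suc (length xs) ≤_) length-us++x∷vs
          (s≤s (length-≤-if-unique-⊆ xs! xs⊆us++vs))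
      where
      length-us++x∷vs : suc (length (us ++ vs)) ≡ length (us ++ x ∷ vs)
      length-us++x∷vs = begin
        suc (length (us ++ vs))          ≡⟨ cong suc (length-++ us) ⟩
        suc (length us + length vs)      ≡⟨ sym (+-suc (length us) (length vs)) ⟩
        length us + length (x ∷ vs)      ≡⟨ sym (length-++ us) ⟩
        length (us ++ x ∷ vs)            ∎
        where open ≡-Reasoning
      xs⊆us++vs : xs ⊆ us ++ vs
      xs⊆us++vs y∈xs with ∈-++⁻ us (xs⊆ys (there y∈xs))
      ... | inj₁ y∈us         = ∈-++⁺ˡ y∈us
      ... | inj₂ (here refl)  = ⊥-elim (lookup x∉xs y∈xs refl)
      ... | inj₂ (there y∈vs) = ∈-++⁺ʳ us y∈vs

  module _ {a b p q} {A : Set a} {B : Set b} {P : Pred A p} {Q : Pred B q}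
           (P? : Decidable P) (Q? : Decidable Q) where

    count-≤-by-retraction : ∀ {xs ys} → Unique xs → (∀ y → y ∈ ys) →
      (f : A → B) (g : B → A) → (∀ {x} → P x → Q (f x)) → (∀ {x} → P x → g (f x) ≡ x) →
      length (filter P? xs) ≤ length (filter Q? ys)
    count-≤-by-retraction {xs} {ys} xs! ys-complete f g f-PQ gf≡id =
      subst (length (filter P? xs) ≤_) (length-map g (filter Q? ys))
        (length-≤-if-unique-⊆ (filter⁺ P? xs!) ⊆-image)
      where
      ⊆-image : filter P? xs ⊆ map g (filter Q? ys)
      ⊆-image {x} x∈ with ∈-filter⁻ P? {xs = xs} x∈
      ... | _ , Px = subst (_∈ map g (filter Q? ys)) (gf≡id Px)
                       (∈-map⁺ g (∈-filter⁺ Q? (ys-complete (f x)) (f-PQ Px)))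

  module _ {a b p q} {A : Set a} {B : Set b} {P : Pred A p} {Q : Pred B q}
           (P? : Decidable P) (Q? : Decidable Q) where

    count-≡-by-bijection : ∀ {xs ys} → Enumeration A xs → Enumeration B ys →
      (f : A → B) (g : B → A) → (∀ {x} → P x → Q (f x)) → (∀ {y} → Q y → P (g y)) →
      (∀ {x} → P x → g (f x) ≡ x) → (∀ {y} → Q y → f (g y) ≡ y) →
      length (filter P? xs) ≡ length (filter Q? ys)
    count-≡-by-bijection (xs! , xs-complete) (ys! , ys-complete) f g f-PQ g-QP gf≡id fg≡id =
      ≤-antisym (count-≤-by-retraction P? Q? xs! ys-complete f g f-PQ gf≡id)
                (count-≤-by-retraction Q? P? ys! xs-complete g f g-QP fg≡id)

  count-cartesianProduct : ∀ {a b p} {A : Set a} {B : Set b} {P : Pred (A × B) p} (P? : Decidable P)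
    (xs : List A) (ys : List B) →
    length (filter P? (cartesianProduct xs ys)) ≡ sum (map (λ x → length (filter (λ y → P? (x , y)) ys)) xs)
  count-cartesianProduct P? [] ys = refl
  count-cartesianProduct P? (x ∷ xs) ys = begin
    length (filter P? (map (x ,_) ys ++ cartesianProduct xs ys))
      ≡⟨ cong length (filter-++ P? (map (x ,_) ys) (cartesianProduct xs ys)) ⟩
    length (filter P? (map (x ,_) ys) ++ filter P? (cartesianProduct xs ys))
      ≡⟨ length-++ (filter P? (map (x ,_) ys)) ⟩
    length (filter P? (map (x ,_) ys)) + length (filter P? (cartesianProduct xs ys))
      ≡⟨ cong₂ _+_ (count-row ys) (count-cartesianProduct P? xs ys) ⟩
    _ ∎
    where
    open ≡-Reasoning
    count-row : ∀ ys → length (filter P? (map (x ,_) ys)) ≡ length (filter (λ y → P? (x , y)) ys)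
    count-row [] = refl
    count-row (y ∷ ys) with P? (x , y)
    ... | yes _ = cong suc (count-row ys)
    ... | no _  = count-row ys

  sum-map-const : ∀ {a} {A : Set a} (h : A → ℕ) {c} → (∀ x → h x ≡ c) → ∀ xs → sum (map h xs) ≡ length xs * c
  sum-map-const h h≡c [] = refl
  sum-map-const h h≡c (x ∷ xs) = cong₂ _+_ (h≡c x) (sum-map-const h h≡c xs)

  sum-allFin-suc : ∀ {n} (h : Fin (suc n) → ℕ) {c} → (∀ x → h (suc x) ≡ c) → sum (map h (allFin (suc n))) ≡ h zero + n * c
  sum-allFin-suc {n} h {c} h∘suc≡c = cong (h zero +_) (begin
    sum (map h (tabulate suc))           ≡⟨ cong sum (map-tabulate suc h) ⟩
    sum (tabulate (h ∘ suc))             ≡⟨ cong sum (sym (map-tabulate id (h ∘ suc))) ⟩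
    sum (map (h ∘ suc) (allFin n))       ≡⟨ sum-map-const (h ∘ suc) h∘suc≡c (allFin n) ⟩
    length (allFin n) * c                ≡⟨ cong (_* c) (length-tabulate {n = n} id) ⟩
    n * c                                ∎)
    where open ≡-Reasoning

module VecEnumeration where

  open import Data.Nat using (zero; suc)
  open import Data.Fin using (Fin)
  open import Data.Vec using (Vec; []; _∷_)
  open import Data.Vec.Properties using (∷-injective)
  open import Data.List using ([]; _∷_; _++_; map; concatMap; allFin; cartesianProductWith)
  open import Data.List.Membership.Propositional.Properties using (∈-cartesianProductWith⁺; ∈-allFin)
  open import Data.List.Relation.Unary.Any using (here)
  open import Data.List.Relation.Unary.Unique.Propositional using ([]; _∷_)
  open import Data.List.Relation.Unary.Unique.Propositional.Properties using (cartesianProductWith⁺; allFin⁺)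
  open import Data.List.Relation.Unary.All using ([])
  open import Data.Product using (_,_)
  open import Relation.Binary.PropositionalEquality
  open import Defs using (allVecs)
  open ListCounting using (Enumeration)

  allVecs-suc : ∀ n k → allVecs n (suc k) ≡ cartesianProductWith _∷_ (allFin n) (allVecs n k)
  allVecs-suc n k = go (allFin n)
    where
    go : ∀ xs → concatMap (λ x → map (x ∷_) (allVecs n k)) xs ≡ cartesianProductWith _∷_ xs (allVecs n k)
    go [] = refl
    go (x ∷ xs) = cong (map (x ∷_) (allVecs n k) ++_) (go xs)

  allVecs-enumeration : ∀ n k → Enumeration (Vec (Fin n) k) (allVecs n k)
  allVecs-enumeration n zero = [] ∷ [] , λ { [] → here refl }
  allVecs-enumeration n (suc k) rewrite allVecs-suc n k with allVecs-enumeration n k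
  ... | vs! , vs-complete =
    cartesianProductWith⁺ _∷_ ∷-injective (allFin⁺ n) vs! ,
    λ { (x ∷ v) → ∈-cartesianProductWith⁺ _∷_ (∈-allFin x) (vs-complete v) }

module LeastWitness where

  open import Data.Nat using (ℕ; zero; suc; _<_; _≤_; s≤s⁻¹)
  open import Data.Nat.Properties using (m≤n⇒m≤1+n; n<1+n; m≤n⇒m<n∨m≡n)
  open import Data.Product using (_×_; _,_; ∃)
  open import Data.Sum using (_⊎_; inj₁; inj₂)
  open import Data.Empty using (⊥-elim)
  open import Relation.Nullary using (yes; no; ¬_)
  open import Relation.Unary using (Pred; Decidable)
  open import Relation.Binary.PropositionalEquality

  Minimal : ∀ {p} → Pred ℕ p → Pred ℕ p
  Minimal P i = P i × (∀ {i′} → i′ < i → ¬ P i′)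

  module _ {p} {P : Pred ℕ p} (P? : Decidable P) where

    none-or-least-below : ∀ k → (∀ {i} → i < k → ¬ P i) ⊎ (∃ λ i → i < k × Minimal P i)
    none-or-least-below zero = inj₁ λ ()
    none-or-least-below (suc k) with none-or-least-below k
    ... | inj₂ (i , i<k , min) = inj₂ (i , m≤n⇒m≤1+n i<k , min)
    ... | inj₁ none with P? k
    ...   | yes Pk  = inj₂ (k , n<1+n k , Pk , none)
    ...   | no ¬Pk  = inj₁ λ i<1+k → case (m≤n⇒m<n∨m≡n (s≤s⁻¹ i<1+k))
      where
      case : ∀ {i} → i < k ⊎ i ≡ k → ¬ P i
      case (inj₁ i<k)  = none i<k
      case (inj₂ refl) = ¬Pk

    least : ∀ {k} → P k → ∃ λ i → i ≤ k × Minimal P i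
    least {k} Pk with none-or-least-below (suc k)
    ... | inj₁ none = ⊥-elim (none (n<1+n k) Pk)
    ... | inj₂ (i , i<1+k , min) = i , s≤s⁻¹ i<1+k , min

module Iteration where

  open import Data.Nat using (zero; suc; _+_)
  open import Data.Nat.Properties using (+-comm)
  open import Data.Fin using (Fin)
  open import Data.Vec using (Vec; lookup)
  open import Relation.Binary.PropositionalEquality
  open import Defs using (iter)

  module _ {n} (σ : Vec (Fin n) n) where

    iter-+ : ∀ i k a → iter σ (i + k) a ≡ iter σ i (iter σ k a)
    iter-+ zero    k a = refl
    iter-+ (suc i) k a = cong (lookup σ) (iter-+ i k a)

    iter-comm : ∀ i k a → iter σ i (iter σ k a) ≡ iter σ k (iter σ i a)
    iter-comm i k a = begin
      iter σ i (iter σ k a) ≡⟨ sym (iter-+ i k a) ⟩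
      iter σ (i + k) a      ≡⟨ cong (λ l → iter σ l a) (+-comm i k) ⟩
      iter σ (k + i) a      ≡⟨ iter-+ k i a ⟩
      iter σ k (iter σ i a) ∎
      where open ≡-Reasoning

    iter-suc : ∀ k a → iter σ (suc k) a ≡ iter σ k (lookup σ a)
    iter-suc k a = iter-comm 1 k a

    iter-periodic : ∀ {j a} → iter σ j a ≡ a → ∀ i → iter σ j (iter σ i a) ≡ iter σ i a
    iter-periodic {j} {a} σʲa≡a i = trans (iter-comm j i a) (cong (iter σ i) σʲa≡a)

module Insertion where

  open import Data.Nat using (ℕ; zero; suc)
  open import Data.Nat.Properties using (n<1+n)
  open import Data.Fin using (Fin; zero; suc; punchOut)
  open import Data.Fin.Properties using (any?; suc-injective; punchOut-injective; pigeonhole; <⇒≢) renaming (_≟_ to _≟ᶠ_)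
  open import Data.Vec using (Vec; lookup; tabulate)
  open import Data.Vec.Properties using (lookup∘tabulate; tabulate∘lookup; tabulate-cong)
  open import Data.Product using (_,_)
  open import Data.Empty using (⊥; ⊥-elim)
  open import Relation.Nullary using (yes; no)
  open import Relation.Binary.PropositionalEquality
  open import Defs using (IsPerm)

  Endo : ℕ → Set
  Endo n = Vec (Fin n) n

  lookup-ext : ∀ {A : Set} {n} {u v : Vec A n} → (∀ i → lookup u i ≡ lookup v i) → u ≡ v
  lookup-ext {u = u} {v} u≗v = trans (sym (tabulate∘lookup u)) (trans (tabulate-cong u≗v) (tabulate∘lookup v))

  -- The points a of ρ become suc a; `insertZero ρ (suc x)` puts the new point 0
  -- right after suc x in its cycle, and `insertZero ρ zero` makes it a fixed point.
  insertZeroAt : ∀ {n} → Endo n → Fin (suc n) → Fin (suc n) → Fin (suc n)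
  insertZeroAt ρ zero    zero    = zero
  insertZeroAt ρ zero    (suc a) = suc (lookup ρ a)
  insertZeroAt ρ (suc x) zero    = suc (lookup ρ x)
  insertZeroAt ρ (suc x) (suc a) with a ≟ᶠ x
  ... | yes _ = zero
  ... | no _  = suc (lookup ρ a)

  insertZero : ∀ {n} → Endo n → Fin (suc n) → Endo (suc n)
  insertZero ρ c = tabulate (insertZeroAt ρ c)

  predecessorOfZero : ∀ {n} → Endo (suc n) → Fin (suc n)
  predecessorOfZero τ with any? (λ x → lookup τ (suc x) ≟ᶠ zero)
  ... | yes (x , _) = suc x
  ... | no _        = zero

  -- The last clause is junk: a permutation never maps both 0 and suc a to 0.
  deleteZeroAt : ∀ {n} → Fin (suc n) → Fin (suc n) → Fin n → Fin n
  deleteZeroAt (suc b) _       a = b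
  deleteZeroAt zero    (suc b) a = b
  deleteZeroAt zero    zero    a = a

  deleteZero : ∀ {n} → Endo (suc n) → Endo n
  deleteZero τ = tabulate (λ a → deleteZeroAt (lookup τ (suc a)) (lookup τ zero) a)

  lookup-deleteZero : ∀ {n} (τ : Endo (suc n)) a → lookup (deleteZero τ) a ≡ deleteZeroAt (lookup τ (suc a)) (lookup τ zero) a
  lookup-deleteZero τ = lookup∘tabulate _

  module _ {n} (ρ : Endo n) where

    lookup-insertZero : ∀ c i → lookup (insertZero ρ c) i ≡ insertZeroAt ρ c i
    lookup-insertZero c = lookup∘tabulate (insertZeroAt ρ c)

    insertZeroAt-pred : ∀ x → insertZeroAt ρ (suc x) (suc x) ≡ zero
    insertZeroAt-pred x with x ≟ᶠ x
    ... | yes _  = refl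
    ... | no x≢x = ⊥-elim (x≢x refl)

    insertZeroAt-other : ∀ x a → a ≢ x → insertZeroAt ρ (suc x) (suc a) ≡ suc (lookup ρ a)
    insertZeroAt-other x a a≢x with a ≟ᶠ x
    ... | yes a≡x = ⊥-elim (a≢x a≡x)
    ... | no _    = refl

    predecessorOfZero-insertZero : ∀ c → predecessorOfZero (insertZero ρ c) ≡ c
    predecessorOfZero-insertZero c with any? (λ x → lookup (insertZero ρ c) (suc x) ≟ᶠ zero)
    predecessorOfZero-insertZero zero    | yes (x , τx≡0) with () ← trans (sym (lookup-insertZero zero (suc x))) τx≡0
    predecessorOfZero-insertZero (suc y) | yes (x , τx≡0) with x ≟ᶠ y
    ... | yes refl = refl
    ... | no x≢y with () ← trans (sym (insertZeroAt-other y x x≢y)) (trans (sym (lookup-insertZero (suc y) (suc x))) τx≡0)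
    predecessorOfZero-insertZero zero    | no _ = refl
    predecessorOfZero-insertZero (suc y) | no none =
      ⊥-elim (none (y , trans (lookup-insertZero (suc y) (suc y)) (insertZeroAt-pred y)))

    deleteZeroAt-insertZeroAt : ∀ c a → deleteZeroAt (insertZeroAt ρ c (suc a)) (insertZeroAt ρ c zero) a ≡ lookup ρ a
    deleteZeroAt-insertZeroAt zero    a = refl
    deleteZeroAt-insertZeroAt (suc x) a with a ≟ᶠ x
    ... | yes refl = refl
    ... | no _     = refl

    deleteZero-insertZero : ∀ c → deleteZero (insertZero ρ c) ≡ ρ
    deleteZero-insertZero c = lookup-ext λ a → begin
      lookup (deleteZero (insertZero ρ c)) a
        ≡⟨ lookup-deleteZero (insertZero ρ c) a ⟩
      deleteZeroAt (lookup (insertZero ρ c) (suc a)) (lookup (insertZero ρ c) zero) a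
        ≡⟨ cong₂ (λ u w → deleteZeroAt u w a) (lookup-insertZero c (suc a)) (lookup-insertZero c zero) ⟩
      deleteZeroAt (insertZeroAt ρ c (suc a)) (insertZeroAt ρ c zero) a
        ≡⟨ deleteZeroAt-insertZeroAt c a ⟩
      lookup ρ a ∎
      where open ≡-Reasoning

  perm-hits-zero : ∀ {n} (τ : Endo (suc n)) → IsPerm τ → (∀ i → zero ≢ lookup τ i) → ⊥
  perm-hits-zero {n} τ τ-inj misses with pigeonhole (n<1+n n) (λ i → punchOut (misses i))
  ... | i , j , i<j , eq = <⇒≢ i<j (τ-inj i j (punchOut-injective (misses i) (misses j) eq))

  deleteZeroAt-suc : ∀ {n} (u w : Fin (suc n)) a → u ≢ zero → suc (deleteZeroAt u w a) ≡ u
  deleteZeroAt-suc zero    w a u≢0 = ⊥-elim (u≢0 refl)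
  deleteZeroAt-suc (suc b) w a u≢0 = refl

  module _ {n} (τ : Endo (suc n)) (τ-inj : IsPerm τ) where

    insertZeroAt-deleteZero : ∀ i → insertZeroAt (deleteZero τ) (predecessorOfZero τ) i ≡ lookup τ i
    insertZeroAt-deleteZero i with any? (λ x → lookup τ (suc x) ≟ᶠ zero)
    insertZeroAt-deleteZero zero | yes (x , τx≡0)
      rewrite lookup-deleteZero τ x | τx≡0
      with lookup τ zero in τ0≡
    ... | zero with () ← τ-inj zero (suc x) (trans τ0≡ (sym τx≡0))
    ... | suc b = refl
    insertZeroAt-deleteZero (suc a) | yes (x , τx≡0) with a ≟ᶠ x
    ... | yes refl = sym τx≡0
    ... | no a≢x rewrite lookup-deleteZero τ a =
      deleteZeroAt-suc (lookup τ (suc a)) _ a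
        (λ τa≡0 → a≢x (suc-injective (τ-inj (suc a) (suc x) (trans τa≡0 (sym τx≡0)))))
    insertZeroAt-deleteZero zero | no none with lookup τ zero in τ0≡
    ... | zero  = refl
    ... | suc b = ⊥-elim (perm-hits-zero τ τ-inj misses)
      where
      misses : ∀ i → zero ≢ lookup τ i
      misses zero    0≡τ0 with () ← trans 0≡τ0 τ0≡
      misses (suc x) 0≡τx = none (x , sym 0≡τx)
    insertZeroAt-deleteZero (suc a) | no none
      rewrite lookup-deleteZero τ a =
      deleteZeroAt-suc (lookup τ (suc a)) _ a (λ τa≡0 → none (a , τa≡0))

    insertZero-deleteZero : insertZero (deleteZero τ) (predecessorOfZero τ) ≡ τ
    insertZero-deleteZero = lookup-ext λ i →
      trans (lookup-insertZero (deleteZero τ) (predecessorOfZero τ) i) (insertZeroAt-deleteZero i)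

  IsInjective : ∀ {n} → (Fin n → Fin n) → Set
  IsInjective f = ∀ i j → f i ≡ f j → i ≡ j

  module _ {n} (ρ : Endo n) where

    insertZeroAt-injective : ∀ c → IsPerm ρ → IsInjective (insertZeroAt ρ c)
    insertZeroAt-injective zero    ρ-inj zero    zero    _ = refl
    insertZeroAt-injective zero    ρ-inj (suc a) (suc b) e = cong suc (ρ-inj a b (suc-injective e))
    insertZeroAt-injective (suc x) ρ-inj zero    zero    _ = refl
    insertZeroAt-injective (suc x) ρ-inj zero    (suc b) e with b ≟ᶠ x
    insertZeroAt-injective (suc x) ρ-inj zero    (suc b) () | yes _
    ... | no b≢x = ⊥-elim (b≢x (sym (ρ-inj x b (suc-injective e))))
    insertZeroAt-injective (suc x) ρ-inj (suc a) zero    e with a ≟ᶠ x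
    insertZeroAt-injective (suc x) ρ-inj (suc a) zero    () | yes _
    ... | no a≢x = ⊥-elim (a≢x (ρ-inj a x (suc-injective e)))
    insertZeroAt-injective (suc x) ρ-inj (suc a) (suc b) e with a ≟ᶠ x | b ≟ᶠ x
    ... | yes refl | yes refl = refl
    insertZeroAt-injective (suc x) ρ-inj (suc a) (suc b) () | yes _ | no _
    insertZeroAt-injective (suc x) ρ-inj (suc a) (suc b) () | no _  | yes _
    ... | no _ | no _ = cong suc (ρ-inj a b (suc-injective e))

    insertZero-perm : ∀ c → IsPerm ρ → IsPerm (insertZero ρ c)
    insertZero-perm c ρ-inj i j e = insertZeroAt-injective c ρ-inj i j
      (trans (sym (lookup-insertZero ρ c i)) (trans e (lookup-insertZero ρ c j)))

    perm-if-insertZeroAt-injective : ∀ c → IsInjective (insertZeroAt ρ c) → IsPerm ρ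
    perm-if-insertZeroAt-injective zero    inj a b e = suc-injective (inj (suc a) (suc b) (cong suc e))
    perm-if-insertZeroAt-injective (suc x) inj a b e
      with a ≟ᶠ x | b ≟ᶠ x | inj (suc a) (suc b) | inj zero (suc b) | inj (suc a) zero
    ... | yes refl | yes refl | _   | _    | _    = refl
    ... | yes refl | no _     | _   | inj₀b | _   with () ← inj₀b (cong suc e)
    ... | no _     | yes refl | _   | _    | injₐ₀ with () ← injₐ₀ (cong suc e)
    ... | no _     | no _     | injₐb | _ | _    = suc-injective (injₐb (cong suc e))

  deleteZero-perm : ∀ {n} (τ : Endo (suc n)) → IsPerm τ → IsPerm (deleteZero τ)
  deleteZero-perm τ τ-inj = perm-if-insertZeroAt-injective (deleteZero τ) (predecessorOfZero τ)
    λ i j e → τ-inj i j (trans (sym (insertZeroAt-deleteZero τ τ-inj i)) (trans e (insertZeroAt-deleteZero τ τ-inj j)))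

module Conjugation where

  open import Data.Nat using (zero; suc)
  open import Data.Fin using (Fin)
  open import Data.Fin.Properties using (_≟_)
  open import Data.Fin.Permutation using (Permutation′; _⟨$⟩ʳ_; _⟨$⟩ˡ_; inverseˡ; inverseʳ; flip)
  import Data.Fin.Permutation.Components as PC
  open import Data.Vec using (lookup; tabulate)
  open import Data.Vec.Properties using (lookup∘tabulate)
  open import Relation.Nullary.Decidable using (dec-true)
  open import Relation.Binary.PropositionalEquality
  open import Defs using (iter; IsPerm)
  open Insertion using (Endo; lookup-ext)

  transpose-matches : ∀ {n} (i j : Fin n) → PC.transpose i j i ≡ j
  transpose-matches i j rewrite dec-true (i ≟ i) refl = refl

  module _ {n} (π : Permutation′ n) where

    conjugate : Endo n → Endo n
    conjugate ρ = tabulate (λ a → π ⟨$⟩ʳ lookup ρ (π ⟨$⟩ˡ a))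

    lookup-conjugate : ∀ ρ a → lookup (conjugate ρ) a ≡ π ⟨$⟩ʳ lookup ρ (π ⟨$⟩ˡ a)
    lookup-conjugate ρ = lookup∘tabulate _

    iter-conjugate : ∀ ρ k a → iter (conjugate ρ) k a ≡ π ⟨$⟩ʳ iter ρ k (π ⟨$⟩ˡ a)
    iter-conjugate ρ zero    a = sym (inverseʳ π)
    iter-conjugate ρ (suc k) a = begin
      lookup (conjugate ρ) (iter (conjugate ρ) k a)           ≡⟨ cong (lookup (conjugate ρ)) (iter-conjugate ρ k a) ⟩
      lookup (conjugate ρ) (π ⟨$⟩ʳ iter ρ k (π ⟨$⟩ˡ a))       ≡⟨ lookup-conjugate ρ _ ⟩
      π ⟨$⟩ʳ lookup ρ (π ⟨$⟩ˡ (π ⟨$⟩ʳ iter ρ k (π ⟨$⟩ˡ a)))   ≡⟨ cong (λ b → π ⟨$⟩ʳ lookup ρ b) (inverseˡ π) ⟩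
      π ⟨$⟩ʳ lookup ρ (iter ρ k (π ⟨$⟩ˡ a))                   ∎
      where open ≡-Reasoning

    conjugate-perm : ∀ ρ → IsPerm ρ → IsPerm (conjugate ρ)
    conjugate-perm ρ ρ-inj i j e = begin
      i                       ≡⟨ sym (inverseʳ π) ⟩
      π ⟨$⟩ʳ (π ⟨$⟩ˡ i)       ≡⟨ cong (π ⟨$⟩ʳ_) (ρ-inj _ _ ρπ⁻¹i≡ρπ⁻¹j) ⟩
      π ⟨$⟩ʳ (π ⟨$⟩ˡ j)       ≡⟨ inverseʳ π ⟩
      j                       ∎
      where
      open ≡-Reasoning
      ρπ⁻¹i≡ρπ⁻¹j : lookup ρ (π ⟨$⟩ˡ i) ≡ lookup ρ (π ⟨$⟩ˡ j)
      ρπ⁻¹i≡ρπ⁻¹j = trans (sym (inverseˡ π))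
        (trans (cong (π ⟨$⟩ˡ_) (trans (sym (lookup-conjugate ρ i)) (trans e (lookup-conjugate ρ j)))) (inverseˡ π))

  conjugate-flip : ∀ {n} (π : Permutation′ n) ρ → conjugate (flip π) (conjugate π ρ) ≡ ρ
  conjugate-flip π ρ = lookup-ext λ a → begin
    lookup (conjugate (flip π) (conjugate π ρ)) a            ≡⟨ lookup-conjugate (flip π) (conjugate π ρ) a ⟩
    π ⟨$⟩ˡ lookup (conjugate π ρ) (π ⟨$⟩ʳ a)                 ≡⟨ cong (π ⟨$⟩ˡ_) (lookup-conjugate π ρ _) ⟩
    π ⟨$⟩ˡ (π ⟨$⟩ʳ lookup ρ (π ⟨$⟩ˡ (π ⟨$⟩ʳ a)))             ≡⟨ inverseˡ π ⟩
    lookup ρ (π ⟨$⟩ˡ (π ⟨$⟩ʳ a))                             ≡⟨ cong (lookup ρ) (inverseˡ π) ⟩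
    lookup ρ a                                               ∎
    where open ≡-Reasoning

module ShortCycles where

  open import Data.Nat using (ℕ; suc; _<_; _≤_; z≤n; s≤s; s≤s⁻¹)
  open import Data.Nat.Properties using (_≤?_; anyUpTo?; allUpTo?; <-irrefl; <-≤-trans)
  open import Data.Fin using (Fin; fromℕ<)
  open import Data.Fin.Properties using (all?; toℕ<n; toℕ-fromℕ<) renaming (_≟_ to _≟ᶠ_)
  open import Data.Fin.Permutation using (Permutation′; _⟨$⟩ʳ_; _⟨$⟩ˡ_; inverseˡ)
  open import Data.Product using (_×_; _,_; ∃; proj₁; proj₂)
  open import Function using (_∘_)
  open import Data.Empty using (⊥-elim)
  open import Relation.Nullary using (Dec; _×-dec_; _→-dec_)
  open import Relation.Binary.PropositionalEquality
  open import Defs using (iter; NoShortCycle)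
  open Insertion using (Endo)
  open Conjugation using (conjugate; iter-conjugate)

  -- All cycles of σ of length ≤ m pass through x and have length ≥ L; a point a is
  -- quantified over with each of its periods suc j ≤ m, not only the least one.
  ShortCyclesThrough : ∀ {n} → ℕ → Fin n → ℕ → Endo n → Set
  ShortCyclesThrough m x L σ =
    ∀ a {j} → j < m → iter σ (suc j) a ≡ a → (∃ λ i → i < suc j × iter σ i a ≡ x) × L ≤ suc j

  shortCyclesThrough? : ∀ {n} m (x : Fin n) L σ → Dec (ShortCyclesThrough m x L σ)
  shortCyclesThrough? m x L σ = all? λ a → allUpTo? (λ j →
    (iter σ (suc j) a ≟ᶠ a) →-dec (anyUpTo? (λ i → iter σ i a ≟ᶠ x) (suc j) ×-dec (L ≤? suc j))) m

  NoShortCycleℕ : ∀ {n} → ℕ → Endo n → Set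
  NoShortCycleℕ m σ = ∀ a {j} → j < m → iter σ (suc j) a ≢ a

  module _ {n} (m : ℕ) (σ : Endo n) where

    noShortCycleℕ : NoShortCycle m σ → NoShortCycleℕ m σ
    noShortCycleℕ none a j<m = none a (fromℕ< j<m) ∘ subst (λ j → iter σ (suc j) a ≡ a) (sym (toℕ-fromℕ< j<m))

    noShortCycle : NoShortCycleℕ m σ → NoShortCycle m σ
    noShortCycle none a j = none a (toℕ<n j)

    shortCyclesThrough-vacuous : ∀ {x L} → NoShortCycleℕ m σ → ShortCyclesThrough m x L σ
    shortCyclesThrough-vacuous none a j<m σʲa≡a = ⊥-elim (none a j<m σʲa≡a)

    noShortCycle-if-length>m : ∀ {x} → ShortCyclesThrough m x (suc m) σ → NoShortCycleℕ m σ
    noShortCycle-if-length>m G a j<m σʲa≡a = <-irrefl refl (<-≤-trans j<m (s≤s⁻¹ (proj₂ (G a j<m σʲa≡a))))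

    shortCyclesThrough-0⇒1 : ∀ {x} → ShortCyclesThrough m x 0 σ → ShortCyclesThrough m x 1 σ
    shortCyclesThrough-0⇒1 G a j<m σʲa≡a = proj₁ (G a j<m σʲa≡a) , s≤s z≤n

    shortCyclesThrough-1⇒0 : ∀ {x} → ShortCyclesThrough m x 1 σ → ShortCyclesThrough m x 0 σ
    shortCyclesThrough-1⇒0 G a j<m σʲa≡a = proj₁ (G a j<m σʲa≡a) , z≤n

    fixedPoint⇒length≤1 : ∀ {x L a} → 0 < m → iter σ 1 a ≡ a → ShortCyclesThrough m x L σ → L ≤ 1
    fixedPoint⇒length≤1 0<m σa≡a G = proj₂ (G _ 0<m σa≡a)

  conjugate-shortCyclesThrough : ∀ {n m x L} (π : Permutation′ n) (ρ : Endo n) →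
    ShortCyclesThrough m x L ρ → ShortCyclesThrough m (π ⟨$⟩ʳ x) L (conjugate π ρ)
  conjugate-shortCyclesThrough π ρ G a {j} j<m e =
    let (i , i<j , ρⁱπ⁻¹a≡x) , L≤j = G (π ⟨$⟩ˡ a) j<m ρʲπ⁻¹a≡π⁻¹a
    in (i , i<j , trans (iter-conjugate π ρ i a) (cong (π ⟨$⟩ʳ_) ρⁱπ⁻¹a≡x)) , L≤j
    where
    ρʲπ⁻¹a≡π⁻¹a : iter ρ (suc j) (π ⟨$⟩ˡ a) ≡ π ⟨$⟩ˡ a
    ρʲπ⁻¹a≡π⁻¹a = trans (sym (inverseˡ π)) (cong (π ⟨$⟩ˡ_) (trans (sym (iter-conjugate π ρ (suc j) a)) e))

module InsertZeroCycles where

  open import Data.Nat using (ℕ; zero; suc; _<_; _≤_; z≤n; s≤s; s≤s⁻¹; z<s)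
  open import Data.Nat.Properties using (_<?_; ≤-trans; <-trans; m≤n⇒m≤1+n; n<1+n; m≤n⇒m<n∨m≡n; ≮⇒≥)
  open import Data.Fin using (Fin; zero; suc)
  open import Data.Fin.Properties using (suc-injective) renaming (_≟_ to _≟ᶠ_)
  open import Data.Vec using (lookup)
  open import Data.Product using (_,_; proj₂)
  open import Data.Sum using (inj₁; inj₂)
  open import Data.Empty using (⊥-elim)
  open import Function using (_∘_)
  open import Relation.Nullary using (yes; no)
  open import Relation.Unary using (Decidable)
  open import Relation.Binary.PropositionalEquality
  open import Defs using (iter)
  open LeastWitness using (Minimal; none-or-least-below; least)
  open Iteration using (iter-suc; iter-periodic)
  open Insertion
  open ShortCycles

  0≢suc : ∀ {n} {b : Fin n} → zero ≢ suc b
  0≢suc ()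

  module FixedZero {n} (m : ℕ) (ρ : Endo n) where

    private
      τ : Endo (suc n)
      τ = insertZero ρ zero

    iter-zero : ∀ k → iter τ k zero ≡ zero
    iter-zero zero    = refl
    iter-zero (suc k) = trans (cong (lookup τ) (iter-zero k)) (lookup-insertZero ρ zero zero)

    iter-suc-lift : ∀ k a → iter τ k (suc a) ≡ suc (iter ρ k a)
    iter-suc-lift zero    a = refl
    iter-suc-lift (suc k) a = trans (cong (lookup τ) (iter-suc-lift k a)) (lookup-insertZero ρ zero (suc (iter ρ k a)))

    noShortCycle-if-insertZero : ∀ {L} → ShortCyclesThrough m zero L τ → NoShortCycleℕ m ρ
    noShortCycle-if-insertZero G a {j} j<m ρʲa≡a with G (suc a) j<m (trans (iter-suc-lift (suc j) a) (cong suc ρʲa≡a))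
    ... | (i , _ , τⁱa≡0) , _ = 0≢suc (trans (sym τⁱa≡0) (iter-suc-lift i a))

    insertZero-shortCyclesThrough : NoShortCycleℕ m ρ → ShortCyclesThrough m zero 1 τ
    insertZero-shortCyclesThrough none zero    j<m _ = (0 , z<s , refl) , s≤s z≤n
    insertZero-shortCyclesThrough none (suc a) {j} j<m e =
      ⊥-elim (none a j<m (suc-injective (trans (sym (iter-suc-lift (suc j) a)) e)))

    insertZero-length≤1 : ∀ {L} → 0 < m → ShortCyclesThrough m zero L τ → L ≤ 1
    insertZero-length≤1 0<m = fixedPoint⇒length≤1 m τ 0<m (iter-zero 1)

  module AfterPoint {n} (m : ℕ) (ρ : Endo n) (x : Fin n) where

    private
      τ : Endo (suc n)
      τ = insertZero ρ (suc x)

    hits : ∀ a → Decidable (λ i → iter ρ i a ≡ x)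
    hits a i = iter ρ i a ≟ᶠ x

    τ-zero : lookup τ zero ≡ suc (lookup ρ x)
    τ-zero = lookup-insertZero ρ (suc x) zero

    τ-pred : lookup τ (suc x) ≡ zero
    τ-pred = trans (lookup-insertZero ρ (suc x) (suc x)) (insertZeroAt-pred ρ x)

    τ-other : ∀ {a} → a ≢ x → lookup τ (suc a) ≡ suc (lookup ρ a)
    τ-other a≢x = trans (lookup-insertZero ρ (suc x) (suc _)) (insertZeroAt-other ρ x _ a≢x)

    τ-into-zero : ∀ {a} → lookup τ (suc a) ≡ zero → a ≡ x
    τ-into-zero {a} τa≡0 with a ≟ᶠ x
    ... | yes a≡x = a≡x
    ... | no a≢x  = ⊥-elim (0≢suc (trans (sym τa≡0) (τ-other a≢x)))

    iter-lift : ∀ k {a} → (∀ {i} → i < k → iter ρ i a ≢ x) → iter τ k (suc a) ≡ suc (iter ρ k a)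
    iter-lift zero    _      = refl
    iter-lift (suc k) misses =
      trans (cong (lookup τ) (iter-lift k (misses ∘ m≤n⇒m≤1+n))) (τ-other (misses (n<1+n k)))

    iter-hit : ∀ {i a} → Minimal (λ i → iter ρ i a ≡ x) i → iter τ (suc i) (suc a) ≡ zero
    iter-hit {i} (ρⁱa≡x , first) =
      trans (cong (lookup τ) (iter-lift i first)) (trans (cong (lookup τ ∘ suc) ρⁱa≡x) τ-pred)

    iter-zero : ∀ k → iter τ (suc k) zero ≡ iter τ k (suc (lookup ρ x))
    iter-zero k = trans (iter-suc τ k zero) (cong (iter τ k) τ-zero)

    zero-cycle-bound : ∀ {L} → ShortCyclesThrough m x L ρ →
      ∀ {j} → j < m → iter τ (suc j) zero ≡ zero → suc L ≤ suc j
    -- At its first return, at time 2 + t, 0 has followed the ρ-orbit of ρ x up to x: ρ^(1+t) x = x.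
    zero-cycle-bound G {j} j<m τʲ0≡0 with least (λ t → iter τ (suc t) zero ≟ᶠ zero) τʲ0≡0
    ... | zero  , _ , τ0≡0 , _ = ⊥-elim (0≢suc (trans (sym τ0≡0) τ-zero))
    ... | suc t , t<j , τ0-returns , first with none-or-least-below (hits (lookup ρ x)) t
    ...   | inj₂ (i , i<t , hit) = ⊥-elim (first (s≤s i<t) (trans (iter-zero (suc i)) (iter-hit hit)))
    ...   | inj₁ misses = s≤s (≤-trans (proj₂ (G x (<-trans t<j j<m) ρˢᵗx≡x)) t<j)
      where
      ρˢᵗx≡x : iter ρ (suc t) x ≡ x
      ρˢᵗx≡x = trans (iter-suc ρ t x) (τ-into-zero (trans (cong (lookup τ) (sym (iter-lift t misses)))
                 (trans (sym (iter-zero (suc t))) τ0-returns)))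

    insertZero-shortCyclesThrough : ∀ {L} → ShortCyclesThrough m x L ρ → ShortCyclesThrough m zero (suc L) τ
    insertZero-shortCyclesThrough G zero    j<m e = (0 , z<s , refl) , zero-cycle-bound G j<m e
    insertZero-shortCyclesThrough G (suc a) {j} j<m e with none-or-least-below (hits a) (suc j)
    ... | inj₁ misses =
      let (_ , i<1+j , ρⁱa≡x) , _ = G a j<m (suc-injective (trans (sym (iter-lift (suc j) misses)) e))
      in ⊥-elim (misses i<1+j ρⁱa≡x)
    ... | inj₂ (i , i<1+j , hit) with m≤n⇒m<n∨m≡n (s≤s⁻¹ i<1+j)
    ...   | inj₂ refl = ⊥-elim (0≢suc (trans (sym (iter-hit hit)) e))
    ...   | inj₁ i<j  = (suc i , s≤s i<j , iter-hit hit) , zero-cycle-bound G j<m τʲ0≡0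
      where
      τʲ0≡0 : iter τ (suc j) zero ≡ zero
      τʲ0≡0 = subst (λ b → iter τ (suc j) b ≡ b) (iter-hit hit) (iter-periodic τ {suc j} e (suc i))

    deleteZero-shortCyclesThrough : ∀ {L} → L ≤ m → ShortCyclesThrough m zero (suc L) τ → ShortCyclesThrough m x L ρ
    deleteZero-shortCyclesThrough L≤m G a {j} j<m e with none-or-least-below (hits a) (suc j)
    ... | inj₁ misses =
      let (i , i<1+j , τⁱa≡0) , _ = G (suc a) j<m (trans (iter-lift (suc j) misses) (cong suc e))
      in ⊥-elim (0≢suc (trans (sym τⁱa≡0) (iter-lift i (λ k<i → misses (<-trans k<i i<1+j)))))
    ... | inj₂ (i , i<1+j , ρⁱa≡x , _) = (i , i<1+j , ρⁱa≡x) , length-bound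
      where
      ρʲρx≡x : iter ρ j (lookup ρ x) ≡ x
      ρʲρx≡x = trans (sym (iter-suc ρ j x)) (subst (λ b → iter ρ (suc j) b ≡ b) ρⁱa≡x (iter-periodic ρ {suc j} e i))
      length-bound : _ ≤ suc j
      length-bound with least (hits (lookup ρ x)) ρʲρx≡x
      ... | t , t≤j , hit with suc t <? m
      ...   | yes 1+t<m = ≤-trans (s≤s⁻¹ (proj₂ (G zero 1+t<m (trans (iter-zero (suc t)) (iter-hit hit))))) (s≤s t≤j)
      ...   | no 1+t≮m = ≤-trans L≤m (≤-trans (≮⇒≥ 1+t≮m) (s≤s t≤j))

module RootedCounts where

  open import Data.Nat using (ℕ; zero; suc; _+_; _*_; _!; _<_; _≤_; z≤n; s≤s; z<s)
  open import Data.Nat.Properties using (≤-refl; <-≤-trans; <-trans; n<1+n; <⇒≤; *-comm; *-assoc; *-zeroʳ)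
  open import Data.Nat.ListAction using (sum)
  open import Data.Fin using (Fin; zero; suc)
  open import Data.Fin.Permutation using (Permutation′; transpose; flip)
  open import Data.List using (map; filter; length; allFin)
  open import Data.List.Properties using (filter-none; filter-≐)
  open import Data.List.Relation.Unary.All using (universal)
  open import Data.Product using (_×_; _,_)
  open import Relation.Nullary using (Dec; ¬_; _×-dec_)
  open import Relation.Binary.PropositionalEquality
  open import Defs using (allVecs; IsPerm; isPerm?; count)
  open ListCounting
  open VecEnumeration using (allVecs-enumeration)
  open Insertion
  open Conjugation
  open ShortCycles
  open InsertZeroCycles

  Through : ∀ {n} → ℕ → Fin n → ℕ → Endo n → Set
  Through m x L σ = IsPerm σ × ShortCyclesThrough m x L σ

  through? : ∀ {n} m (x : Fin n) L σ → Dec (Through m x L σ)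
  through? m x L σ = isPerm? σ ×-dec shortCyclesThrough? m x L σ

  countThrough : ∀ n → ℕ → Fin n → ℕ → ℕ
  countThrough n m x L = length (filter (through? m x L) (allVecs n n))

  countThrough-independent : ∀ {n} m (x y : Fin n) L → countThrough n m x L ≡ countThrough n m y L
  countThrough-independent {n} m x y L =
    count-≡-by-bijection (through? m x L) (through? m y L) (allVecs-enumeration n n) (allVecs-enumeration n n)
      (conjugate π) (conjugate (flip π))
      (λ { {ρ} (ρ-perm , G) → conjugate-perm π ρ ρ-perm ,
             subst (λ z → ShortCyclesThrough m z L (conjugate π ρ)) (transpose-matches x y) (conjugate-shortCyclesThrough π ρ G) })
      (λ { {ρ} (ρ-perm , G) → conjugate-perm (flip π) ρ ρ-perm ,
             subst (λ z → ShortCyclesThrough m z L (conjugate (flip π) ρ)) (transpose-matches y x) (conjugate-shortCyclesThrough (flip π) ρ G) })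
      (λ {ρ} _ → conjugate-flip π ρ) (λ {ρ} _ → conjugate-flip (flip π) ρ)
    where
    π : Permutation′ n
    π = transpose x y

  rooted : ℕ → ℕ → ℕ → ℕ
  rooted n m L = countThrough (suc n) m zero L

  InsertedThrough : ∀ {n} → ℕ → ℕ → Fin (suc n) × Endo n → Set
  InsertedThrough m L (c , ρ) = IsPerm ρ × ShortCyclesThrough m zero L (insertZero ρ c)

  insertedThrough? : ∀ {n} m L (cρ : Fin (suc n) × Endo n) → Dec (InsertedThrough m L cρ)
  insertedThrough? m L (c , ρ) = isPerm? ρ ×-dec shortCyclesThrough? m zero L (insertZero ρ c)

  insertedCount : ∀ n → ℕ → ℕ → Fin (suc n) → ℕ
  insertedCount n m L c = length (filter (λ ρ → insertedThrough? m L (c , ρ)) (allVecs n n))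

  rooted-by-insertion : ∀ n m L → rooted n m L ≡ sum (map (insertedCount n m L) (allFin (suc n)))
  rooted-by-insertion n m L = trans
    (count-≡-by-bijection (through? m zero L) (insertedThrough? m L)
      (allVecs-enumeration (suc n) (suc n))
      (cartesianProduct-enumeration (allFin-enumeration (suc n)) (allVecs-enumeration n n))
      (λ τ → predecessorOfZero τ , deleteZero τ) (λ (c , ρ) → insertZero ρ c)
      (λ { {τ} (τ-perm , G) → deleteZero-perm τ τ-perm ,
             subst (ShortCyclesThrough m zero L) (sym (insertZero-deleteZero τ τ-perm)) G })
      (λ { {c , ρ} (ρ-perm , G) → insertZero-perm ρ c ρ-perm , G })
      (λ { {τ} (τ-perm , _) → insertZero-deleteZero τ τ-perm })
      (λ { {c , ρ} _ → cong₂ _,_ (predecessorOfZero-insertZero ρ c) (deleteZero-insertZero ρ c) }))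
    (count-cartesianProduct (insertedThrough? m L) (allFin (suc n)) (allVecs n n))

  module _ (n m : ℕ) where

    insertedCount-fixed : insertedCount n m 1 zero ≡ count n m
    insertedCount-fixed = cong length (filter-≐ _ _
      ( (λ { {ρ} (ρ-perm , G) → ρ-perm , noShortCycle m ρ (FixedZero.noShortCycle-if-insertZero m ρ G) })
      , (λ { {ρ} (ρ-perm , none) → ρ-perm , FixedZero.insertZero-shortCyclesThrough m ρ (noShortCycleℕ m ρ none) }))
      (allVecs n n))

    insertedCount-fixed-long : ∀ {L} → 0 < m → insertedCount n m (2 + L) zero ≡ 0
    insertedCount-fixed-long 0<m = cong length (filter-none _
      (universal (λ ρ (_ , G) → 2+L≰1 (FixedZero.insertZero-length≤1 m ρ 0<m G)) (allVecs n n)))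
      where
      2+L≰1 : ∀ {L} → ¬ 2 + L ≤ 1
      2+L≰1 (s≤s ())

  insertedCount-after : ∀ n m {L} → L ≤ m → (x : Fin (suc n)) → insertedCount (suc n) m (suc L) (suc x) ≡ rooted n m L
  insertedCount-after n m {L} L≤m x = trans
    (cong length (filter-≐ _ _
      ( (λ { {ρ} (ρ-perm , G) → ρ-perm , AfterPoint.deleteZero-shortCyclesThrough m ρ x L≤m G })
      , (λ { {ρ} (ρ-perm , G) → ρ-perm , AfterPoint.insertZero-shortCyclesThrough m ρ x G }))
      (allVecs (suc n) (suc n))))
    (countThrough-independent m x zero L)

  rooted-0≡rooted-1 : ∀ n m → rooted n m 0 ≡ rooted n m 1
  rooted-0≡rooted-1 n m = cong length (filter-≐ _ _
    ( (λ { {τ} (τ-perm , G) → τ-perm , shortCyclesThrough-0⇒1 m τ G })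
    , (λ { {τ} (τ-perm , G) → τ-perm , shortCyclesThrough-1⇒0 m τ G }))
    (allVecs (suc n) (suc n)))

  count≡rooted : ∀ n m → count (suc n) m ≡ rooted n m (suc m)
  count≡rooted n m = cong length (filter-≐ _ _
    ( (λ { {σ} (σ-perm , none) → σ-perm , shortCyclesThrough-vacuous m σ (noShortCycleℕ m σ none) })
    , (λ { {σ} (σ-perm , G) → σ-perm , noShortCycle m σ (noShortCycle-if-length>m m σ G) }))
    (allVecs (suc n) (suc n)))

  rooted-long-zero : ∀ m {L} → L < m → rooted 0 m (2 + L) ≡ 0
  rooted-long-zero m L<m =
    trans (rooted-by-insertion 0 m _) (cong (_+ 0) (insertedCount-fixed-long 0 m (<-≤-trans z<s L<m)))

  rooted-long-suc : ∀ n m {L} → L < m → rooted (suc n) m (2 + L) ≡ suc n * rooted n m (suc L)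
  rooted-long-suc n m {L} L<m = begin
    rooted (suc n) m (2 + L)
      ≡⟨ rooted-by-insertion (suc n) m (2 + L) ⟩
    sum (map (insertedCount (suc n) m (2 + L)) (allFin (suc (suc n))))
      ≡⟨ sum-allFin-suc (insertedCount (suc n) m (2 + L)) (insertedCount-after n m L<m) ⟩
    insertedCount (suc n) m (2 + L) zero + suc n * rooted n m (suc L)
      ≡⟨ cong (_+ suc n * rooted n m (suc L)) (insertedCount-fixed-long (suc n) m (<-≤-trans z<s L<m)) ⟩
    suc n * rooted n m (suc L) ∎
    where open ≡-Reasoning

  rooted-1-zero : ∀ m → rooted 0 m 1 ≡ 1
  rooted-1-zero m = trans (rooted-by-insertion 0 m 1) (cong (_+ 0) (insertedCount-fixed 0 m))

  rooted-1-suc : ∀ n m → rooted (suc n) m 1 ≡ count (suc n) m + suc n * rooted n m 1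
  rooted-1-suc n m = begin
    rooted (suc n) m 1
      ≡⟨ rooted-by-insertion (suc n) m 1 ⟩
    sum (map (insertedCount (suc n) m 1) (allFin (suc (suc n))))
      ≡⟨ sum-allFin-suc (insertedCount (suc n) m 1) (insertedCount-after n m z≤n) ⟩
    insertedCount (suc n) m 1 zero + suc n * rooted n m 0
      ≡⟨ cong₂ (λ a b → a + suc n * b) (insertedCount-fixed (suc n) m) (rooted-0≡rooted-1 n m) ⟩
    count (suc n) m + suc n * rooted n m 1 ∎
    where open ≡-Reasoning

  rooted-chain : ∀ m k d → d ≤ m → rooted (d + k) m (suc d) * k ! ≡ (d + k) ! * rooted k m 1
  rooted-chain m k zero    _   = *-comm (rooted k m 1) (k !)
  rooted-chain m k (suc d) d<m = begin
    rooted (suc (d + k)) m (2 + d) * k !            ≡⟨ cong (_* k !) (rooted-long-suc (d + k) m d<m) ⟩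
    suc (d + k) * rooted (d + k) m (suc d) * k !    ≡⟨ *-assoc (suc (d + k)) (rooted (d + k) m (suc d)) (k !) ⟩
    suc (d + k) * (rooted (d + k) m (suc d) * k !)  ≡⟨ cong (suc (d + k) *_) (rooted-chain m k d (<⇒≤ d<m)) ⟩
    suc (d + k) * ((d + k) ! * rooted k m 1)        ≡⟨ *-assoc (suc (d + k)) ((d + k) !) (rooted k m 1) ⟨
    suc (d + k) ! * rooted k m 1                    ∎
    where open ≡-Reasoning

  count-factorial : ∀ m k → count (suc (m + k)) m * k ! ≡ (m + k) ! * rooted k m 1
  count-factorial m k = trans (cong (_* k !) (count≡rooted (m + k) m)) (rooted-chain m k m ≤-refl)

  rooted-vanishes : ∀ m n {L} → n ≤ L → L < m → rooted n m (2 + L) ≡ 0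
  rooted-vanishes m zero            _         L<m = rooted-long-zero m L<m
  rooted-vanishes m (suc n) {suc L} (s≤s n≤L) L<m = begin
    rooted (suc n) m (2 + suc L)     ≡⟨ rooted-long-suc n m L<m ⟩
    suc n * rooted n m (2 + L)       ≡⟨ cong (suc n *_) (rooted-vanishes m n n≤L (<-trans (n<1+n L) L<m)) ⟩
    suc n * 0                        ≡⟨ *-zeroʳ (suc n) ⟩
    0                                ∎
    where open ≡-Reasoning

  count-vanishes : ∀ {i m} → i < m → count (suc i) m ≡ 0
  count-vanishes {i} {suc m} (s≤s i≤m) = trans (count≡rooted i (suc m)) (rooted-vanishes (suc m) i i≤m (n<1+n m))

module Fractions where

  open import Data.Nat as ℕ using (ℕ; suc; NonZero)
  open import Data.Nat.Solver using (module +-*-Solver)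
  import Data.Integer as ℤ
  open import Data.Integer using (+_)
  open import Data.Integer.Properties using (pos-*)
  open import Data.Rational using (_/_; _+_; _*_; toℚᵘ)
  open import Data.Rational.Properties using (toℚᵘ-injective; toℚᵘ-fromℚᵘ; fromℚᵘ-cong; toℚᵘ-homo-+; toℚᵘ-homo-*)
  open import Data.Rational.Unnormalised as ℚᵘ using (mkℚᵘ; *≡*)
  import Data.Rational.Unnormalised.Properties as ℚᵘ
  open import Relation.Binary.PropositionalEquality
  open +-*-Solver

  -- `mkℚᵘ (+ a) b` denotes a / (1 + b).
  mkℚᵘ-cross : ∀ a b c d → a ℕ.* suc d ≡ c ℕ.* suc b → mkℚᵘ (+ a) b ℚᵘ.≃ mkℚᵘ (+ c) d
  mkℚᵘ-cross a b c d eq = *≡* (trans (sym (pos-* a (suc d))) (trans (cong +_ eq) (pos-* c (suc b))))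

  /-cross : ∀ {a b c d} .{{_ : NonZero b}} .{{_ : NonZero d}} → a ℕ.* d ≡ c ℕ.* b → + a / b ≡ + c / d
  /-cross {a} {suc b} {c} {suc d} eq = fromℚᵘ-cong (mkℚᵘ-cross a b c d eq)

  toℚᵘ-/ : ∀ a d → toℚᵘ (+ a / suc d) ℚᵘ.≃ mkℚᵘ (+ a) d
  toℚᵘ-/ a d = toℚᵘ-fromℚᵘ (mkℚᵘ (+ a) d)

  /-+-/ : ∀ a c d .{{_ : NonZero d}} → + a / d + + c / d ≡ + (a ℕ.+ c) / d
  /-+-/ a c (suc d) = toℚᵘ-injective (begin
    toℚᵘ (+ a / suc d + + c / suc d)
      ≈⟨ toℚᵘ-homo-+ (+ a / suc d) (+ c / suc d) ⟩
    toℚᵘ (+ a / suc d) ℚᵘ.+ toℚᵘ (+ c / suc d)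
      ≈⟨ ℚᵘ.+-cong (toℚᵘ-/ a d) (toℚᵘ-/ c d) ⟩
    mkℚᵘ (+ a ℤ.* + suc d ℤ.+ + c ℤ.* + suc d) (d ℕ.+ d ℕ.* suc d)
      ≡⟨ cong₂ (λ x y → mkℚᵘ (x ℤ.+ y) (d ℕ.+ d ℕ.* suc d)) (sym (pos-* a (suc d))) (sym (pos-* c (suc d))) ⟩
    mkℚᵘ (+ (a ℕ.* suc d ℕ.+ c ℕ.* suc d)) (d ℕ.+ d ℕ.* suc d)
      ≈⟨ mkℚᵘ-cross _ _ (a ℕ.+ c) d
           (solve 3 (λ a c D → (a :* D :+ c :* D) :* D := (a :+ c) :* (D :* D)) refl a c (suc d)) ⟩
    mkℚᵘ (+ (a ℕ.+ c)) d
      ≈⟨ ℚᵘ.≃-sym (toℚᵘ-/ (a ℕ.+ c) d) ⟩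
    toℚᵘ (+ (a ℕ.+ c) / suc d) ∎)
    where open ℚᵘ.≃-Reasoning

  integer-*-/ : ∀ n a d .{{_ : NonZero d}} → (+ n / 1) * (+ a / d) ≡ + (n ℕ.* a) / d
  integer-*-/ n a (suc d) = toℚᵘ-injective (begin
    toℚᵘ ((+ n / 1) * (+ a / suc d))
      ≈⟨ toℚᵘ-homo-* (+ n / 1) (+ a / suc d) ⟩
    toℚᵘ (+ n / 1) ℚᵘ.* toℚᵘ (+ a / suc d)
      ≈⟨ ℚᵘ.*-cong (toℚᵘ-/ n 0) (toℚᵘ-/ a d) ⟩
    mkℚᵘ (+ n ℤ.* + a) (d ℕ.+ 0 ℕ.* suc d)
      ≡⟨ cong (λ x → mkℚᵘ x (d ℕ.+ 0 ℕ.* suc d)) (sym (pos-* n a)) ⟩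
    mkℚᵘ (+ (n ℕ.* a)) (d ℕ.+ 0 ℕ.* suc d)
      ≈⟨ mkℚᵘ-cross _ _ (n ℕ.* a) d
           (solve 3 (λ n a D → n :* a :* D := n :* a :* (D :+ con 0 :* D)) refl n a (suc d)) ⟩
    mkℚᵘ (+ (n ℕ.* a)) d
      ≈⟨ ℚᵘ.≃-sym (toℚᵘ-/ (n ℕ.* a) d) ⟩
    toℚᵘ (+ (n ℕ.* a) / suc d) ∎)
    where open ℚᵘ.≃-Reasoning

module RationalSums where

  open import Data.Nat using (ℕ; suc)
  open import Data.List using (List; []; _∷_; _++_; [_]; foldr; filter; upTo)
  open import Data.List.Properties using (upTo-∷ʳ)
  open import Data.List.Relation.Unary.All using (All; []; _∷_)
  open import Data.Rational using (ℚ; 0ℚ; _+_)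
  open import Data.Rational.Properties using (+-identityˡ; +-identityʳ; +-assoc)
  open import Relation.Nullary using (¬_; yes; no)
  open import Relation.Unary using (Pred; Decidable)
  open import Relation.Binary.PropositionalEquality hiding ([_])

  sumℚ : (ℕ → ℚ) → List ℕ → ℚ
  sumℚ f = foldr (λ i acc → f i + acc) 0ℚ

  sumℚ-++ : ∀ f xs ys → sumℚ f (xs ++ ys) ≡ sumℚ f xs + sumℚ f ys
  sumℚ-++ f []       ys = sym (+-identityˡ (sumℚ f ys))
  sumℚ-++ f (x ∷ xs) ys = trans (cong (f x +_) (sumℚ-++ f xs ys)) (sym (+-assoc (f x) (sumℚ f xs) (sumℚ f ys)))

  sumℚ-upTo-suc : ∀ f k → sumℚ f (upTo (suc k)) ≡ sumℚ f (upTo k) + f k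
  sumℚ-upTo-suc f k = begin
    sumℚ f (upTo (suc k))           ≡⟨ cong (sumℚ f) (sym (upTo-∷ʳ k)) ⟩
    sumℚ f (upTo k ++ [ k ])        ≡⟨ sumℚ-++ f (upTo k) [ k ] ⟩
    sumℚ f (upTo k) + (f k + 0ℚ)    ≡⟨ cong (sumℚ f (upTo k) +_) (+-identityʳ (f k)) ⟩
    sumℚ f (upTo k) + f k           ∎
    where open ≡-Reasoning

  sumℚ-filter : ∀ {p} {P : Pred ℕ p} (P? : Decidable P) f {xs} →
    All (λ i → ¬ P i → f i ≡ 0ℚ) xs → sumℚ f (filter P? xs) ≡ sumℚ f xs
  sumℚ-filter P? f [] = refl
  sumℚ-filter P? f {x ∷ xs} (vanishes ∷ rest) with P? x
  ... | yes _   = cong (f x +_) (sumℚ-filter P? f rest)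
  ... | no ¬Px = begin
    sumℚ f (filter P? xs)          ≡⟨ sumℚ-filter P? f rest ⟩
    sumℚ f xs                      ≡⟨ +-identityˡ (sumℚ f xs) ⟨
    0ℚ + sumℚ f xs                 ≡⟨ cong (_+ sumℚ f xs) (vanishes ¬Px) ⟨
    f x + sumℚ f xs                ∎
    where open ≡-Reasoning

open import Data.Nat as ℕ using (ℕ; zero; suc; _<_; _!; NonZero)
open import Data.Nat.Properties using (_<?_; _!≢0; m≤n⇒∃[o]m+o≡n; m+n∸m≡n; +-suc; ≮⇒≥; *-assoc)
open import Data.Nat.Solver using (module +-*-Solver)
open import Data.Integer using (+_)
open import Data.List using (filter; upTo; applyUpTo)
open import Data.List.Relation.Unary.All.Properties using (applyUpTo⁺₁)
open import Data.Rational using (ℚ; _+_; _*_; 0ℚ; 1ℚ; _/_)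
open import Data.Rational.Properties using (+-comm; 0/n≡0)
open import Data.Product using (_,_; ∃)
open import Relation.Binary.PropositionalEquality
open import Defs
open RootedCounts using (rooted; rooted-1-zero; rooted-1-suc; count-factorial; count-vanishes)
open Fractions using (/-cross; /-+-/; integer-*-/)
open RationalSums using (sumℚ; sumℚ-upTo-suc; sumℚ-filter)

-- Instance search does not find NonZero (k !) on its own, hence the local instances.
p-vanishes : ∀ {i m} → i < m → p (suc i) m ≡ 0ℚ
p-vanishes {i} i<m = trans (cong (λ c → + c / suc i !) (count-vanishes i<m)) (0/n≡0 (suc i !))
  where
  instance
    1+i!≢0 : NonZero (suc i !)
    1+i!≢0 = suc i !≢0

rootedRatio : ℕ → ℕ → ℚ
rootedRatio k m = + rooted k m 1 / k !
  where
  instance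
    k!≢0 : NonZero (k !)
    k!≢0 = k !≢0

n·p≡rootedRatio : ∀ m k → (+ suc (m ℕ.+ k) / 1) * p (suc (m ℕ.+ k)) m ≡ rootedRatio k m
n·p≡rootedRatio m k = trans (integer-*-/ (suc (m ℕ.+ k)) c (suc (m ℕ.+ k) !))
  (/-cross {a = suc (m ℕ.+ k) ℕ.* c} {b = suc (m ℕ.+ k) !} {c = r} {d = k !} (begin
    suc (m ℕ.+ k) ℕ.* c ℕ.* k !               ≡⟨ *-assoc (suc (m ℕ.+ k)) c (k !) ⟩
    suc (m ℕ.+ k) ℕ.* (c ℕ.* k !)             ≡⟨ cong (suc (m ℕ.+ k) ℕ.*_) (count-factorial m k) ⟩
    suc (m ℕ.+ k) ℕ.* ((m ℕ.+ k) ! ℕ.* r)     ≡⟨ solve 3 (λ s F r → s :* (F :* r) := r :* (s :* F)) refl (suc (m ℕ.+ k)) ((m ℕ.+ k) !) r ⟩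
    r ℕ.* suc (m ℕ.+ k) !                     ∎))
  where
  open ≡-Reasoning
  open +-*-Solver
  instance
    k!≢0 : NonZero (k !)
    k!≢0 = k !≢0
    n!≢0 : NonZero (suc (m ℕ.+ k) !)
    n!≢0 = suc (m ℕ.+ k) !≢0
  c r : ℕ
  c = count (suc (m ℕ.+ k)) m
  r = rooted k m 1

rootedRatio-partialSum : ∀ m k → rootedRatio k m ≡ sumℚ (λ i → p i m) (upTo (suc k))
rootedRatio-partialSum m zero    = cong (λ r → + r / 1) (rooted-1-zero m)
rootedRatio-partialSum m (suc k) = begin
  rootedRatio (suc k) m
    ≡⟨ cong (λ r → + r / suc k !) (rooted-1-suc k m) ⟩
  + (count (suc k) m ℕ.+ suc k ℕ.* r) / suc k !
    ≡⟨ /-+-/ (count (suc k) m) (suc k ℕ.* r) (suc k !) ⟨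
  p (suc k) m + + (suc k ℕ.* r) / suc k !
    ≡⟨ cong (_+_ (p (suc k) m)) (/-cross {a = suc k ℕ.* r} {c = r}
         (solve 3 (λ s r K → s :* r :* K := r :* (s :* K)) refl (suc k) r (k !))) ⟩
  p (suc k) m + rootedRatio k m
    ≡⟨ cong (_+_ (p (suc k) m)) (rootedRatio-partialSum m k) ⟩
  p (suc k) m + sumℚ (λ i → p i m) (upTo (suc k))
    ≡⟨ +-comm (p (suc k) m) _ ⟩
  sumℚ (λ i → p i m) (upTo (suc k)) + p (suc k) m
    ≡⟨ sumℚ-upTo-suc (λ i → p i m) (suc k) ⟨
  sumℚ (λ i → p i m) (upTo (suc (suc k))) ∎
  where
  open ≡-Reasoning
  open +-*-Solver
  instance
    k!≢0 : NonZero (k !)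
    k!≢0 = k !≢0
    1+k!≢0 : NonZero (suc k !)
    1+k!≢0 = suc k !≢0
  r : ℕ
  r = rooted k m 1

partialSum≡1+sumP : ∀ m k → sumℚ (λ i → p i m) (upTo (suc k)) ≡ 1ℚ + sumP (suc (m ℕ.+ k)) m
partialSum≡1+sumP m k = begin
  -- upTo (suc k) = 0 ∷ applyUpTo suc k, p 0 m = 1ℚ, and filter (m <?_) drops 0, all by computation.
  1ℚ + sumℚ (λ i → p i m) (applyUpTo suc k)
    ≡⟨ cong (_+_ 1ℚ) (sumℚ-filter (m <?_) (λ i → p i m) (applyUpTo⁺₁ suc k λ _ m≮1+i → p-vanishes (≮⇒≥ m≮1+i))) ⟨
  1ℚ + sumℚ (λ i → p i m) (filter (m <?_) (upTo (suc k)))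
    ≡⟨ cong (λ l → 1ℚ + sumℚ (λ i → p i m) (filter (m <?_) (upTo l))) (sym 1+m+k∸m≡1+k) ⟩
  1ℚ + sumP (suc (m ℕ.+ k)) m ∎
  where
  open ≡-Reasoning
  1+m+k∸m≡1+k : suc (m ℕ.+ k) ℕ.∸ m ≡ suc k
  1+m+k∸m≡1+k = trans (cong (ℕ._∸ m) (sym (+-suc m k))) (m+n∸m≡n m (suc k))

lemma2p3 : (n m : ℕ) → m < n → ((+ n) / 1) * p n m ≡ 1ℚ + sumP n m
lemma2p3 n m m<n = shifted (m≤n⇒∃[o]m+o≡n m<n)
  where
  -- Matching with `with` instead would normalise the goal, unfolding p and sumP.
  shifted : ∀ {n} → ∃ (λ k → suc m ℕ.+ k ≡ n) → ((+ n) / 1) * p n m ≡ 1ℚ + sumP n m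
  shifted (k , refl) = begin
    (+ suc (m ℕ.+ k) / 1) * p (suc (m ℕ.+ k)) m   ≡⟨ n·p≡rootedRatio m k ⟩
    rootedRatio k m                                ≡⟨ rootedRatio-partialSum m k ⟩
    sumℚ (λ i → p i m) (upTo (suc k))              ≡⟨ partialSum≡1+sumP m k ⟩
    1ℚ + sumP (suc (m ℕ.+ k)) m                    ∎
    where open ≡-Reasoning
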